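{- Let $S$ be a numerical semigroup with multiplicity $m$ and embedding dimension $\nu$, and let $\mathrm{Ap}(S,m)=\{w_0=0<w_1<\dots<w_{m-1}\}$. If $m-\nu>\binom{\alpha}{2}=\frac{\alpha(\alpha-1)}{2}$ for some positive integer $\alpha$, then $w_{m-1}\ge w_1+w_\alpha$.
   Context: A numerical semigroup is a submonoid of $(\mathbb N,+)$ with finite complement; $m$ is its smallest nonzero element and $\nu$ its minimal number of generators. $\mathrm{Ap}(S,m)=\{s\in S: s-m\notin S\}$, an $m$-element set listed increasingly. -}

module Defs where

open import Data.Nat using (ℕ; _+_; _≤_; _<_)
open import Data.Product using (Σ; ∃; _×_)
open import Data.List using (List; length)
open import Data.List.Membership.Propositional using (_∈_)
open import Data.List.Relation.Unary.Unique.Propositional using (Unique)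
open import Relation.Binary.PropositionalEquality using (_≡_; _≢_)
open import Relation.Nullary using (¬_; Dec)
open import Function.Bundles using (_⇔_)

record NumericalSemigroup : Set₁ where
  field
    mem      : ℕ → Set
    mem?     : (n : ℕ) → Dec (mem n)
    zero∈    : mem 0
    closed   : ∀ a b → mem a → mem b → mem (a + b)
    cofinite : ∃ λ F → ∀ n → F < n → mem n

open NumericalSemigroup public

IsMultiplicity : NumericalSemigroup → ℕ → Set
IsMultiplicity S m = mem S m × m ≢ 0 × (∀ s → mem S s → s ≢ 0 → m ≤ s)

IsMinimalGenerator : NumericalSemigroup → ℕ → Set
IsMinimalGenerator S x =
  mem S x × x ≢ 0 ×
  ¬ (∃ λ a → ∃ λ b → mem S a × a ≢ 0 × mem S b × b ≢ 0 × a + b ≡ x)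

IsEmbeddingDimension : NumericalSemigroup → ℕ → Set
IsEmbeddingDimension S ν =
  Σ (List ℕ) λ L → Unique L × (∀ x → (x ∈ L) ⇔ IsMinimalGenerator S x) × length L ≡ ν

InApery : NumericalSemigroup → ℕ → ℕ → Set
InApery S n s = mem S s × ¬ (Σ (n ≤ s) λ _ → Σ ℕ λ t → t + n ≡ s × mem S t)

-- w 0 < w 1 < … < w (m-1) is an increasing enumeration of Ap(S,m)
-- (values of w at indices ≥ m are irrelevant).
IsAperyListing : NumericalSemigroup → ℕ → (ℕ → ℕ) → Set
IsAperyListing S m w =
  (∀ i j → i < j → j < m → w i < w j) ×
  (∀ i → i < m → InApery S m (w i)) ×
  (∀ s → InApery S m s → ∃ λ i → i < m × w i ≡ s)

-- Suppose w_{m-1} < w_1 + w_α. A nonzero Apéry element w_k that is not a minimal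
-- generator splits as a sum of two nonzero elements of S, which again lie in
-- Ap(S,m), so w_k = w_i + w_j with 1 ≤ i ≤ j; as w_i + w_j ≤ w_{m-1} < w_1 + w_α,
-- monotonicity forces j < α. Hence w_1, …, w_{m-1} and m, all distinct, lie among
-- the ν minimal generators and the C(α,2) sums w_i + w_j with 1 ≤ i ≤ j < α,
-- giving m ≤ ν + C(α,2).
module Submission where

open import Defs
open import Data.Nat using (ℕ; zero; suc; _+_; _∸_; _≤_; _<_; z≤n; s≤s; s≤s⁻¹; z<s; _≟_; _≤?_)
open import Data.Nat.Properties
open import Data.Nat.Combinatorics using (_C_; nCk+nC[k+1]≡[n+1]C[k+1]; nC1≡n)
open import Data.List using (List; []; _∷_; _++_; length; applyUpTo)
open import Data.List.Properties using (length-++; length-applyUpTo)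
open import Data.List.Membership.Propositional using (_∈_)
open import Data.List.Membership.Propositional.Properties
  using (∈-++⁺ˡ; ∈-++⁺ʳ; ∈-applyUpTo⁺; ∈-applyUpTo⁻)
open import Data.List.Membership.DecPropositional _≟_ using (_∈?_)
open import Data.List.Relation.Binary.Subset.Propositional using (_⊆_)
open import Data.List.Relation.Unary.Any using (here; there)
open import Data.List.Relation.Unary.All as All using (All)
open import Data.List.Relation.Unary.AllPairs using (_∷_)
open import Data.List.Relation.Unary.Unique.Propositional using (Unique)
open import Data.List.Relation.Unary.Unique.Propositional.Properties using (applyUpTo⁺₁)
open import Data.Product using (∃; ∃₂; _×_; _,_; proj₁; proj₂)
open import Data.Sum using (_⊎_; inj₁; inj₂; [_,_])
open import Function.Base using (_∘_)
open import Function.Bundles using (Equivalence)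
open import Relation.Nullary using (¬_; yes; no; contradiction)
open import Relation.Binary.PropositionalEquality
  using (_≡_; _≢_; refl; sym; trans; cong; cong₂; subst; subst₂; module ≡-Reasoning)

module _ {A : Set} where

  remove : ∀ {x : A} xs → x ∈ xs → List A
  remove (_ ∷ xs) (here _)  = xs
  remove (y ∷ xs) (there p) = y ∷ remove xs p

  length-remove : ∀ {x : A} xs (p : x ∈ xs) → length xs ≡ suc (length (remove xs p))
  length-remove (_ ∷ _)  (here _)  = refl
  length-remove (_ ∷ xs) (there p) = cong suc (length-remove xs p)

  ∈-remove⁺ : ∀ {x z : A} xs (p : x ∈ xs) → z ∈ xs → z ≢ x → z ∈ remove xs p
  ∈-remove⁺ (_ ∷ _)  (here refl) (here refl) z≢x = contradiction refl z≢x
  ∈-remove⁺ (_ ∷ _)  (here refl) (there q)   _   = q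
  ∈-remove⁺ (_ ∷ _)  (there p)   (here refl) _   = here refl
  ∈-remove⁺ (_ ∷ xs) (there p)   (there q)   z≢x = there (∈-remove⁺ xs p q z≢x)

  Unique∧⊆⇒length≤ : ∀ {xs ys : List A} → Unique xs → xs ⊆ ys → length xs ≤ length ys
  Unique∧⊆⇒length≤ {[]}     _          _  = z≤n
  Unique∧⊆⇒length≤ {x ∷ xs} {ys} (x∉xs ∷ u) xs⊆ys = begin
    suc (length xs)                 ≤⟨ s≤s (Unique∧⊆⇒length≤ u xs⊆ys─x) ⟩
    suc (length (remove ys x∈ys))   ≡⟨ length-remove ys x∈ys ⟨
    length ys                       ∎
    where
    open ≤-Reasoning
    x∈ys : x ∈ ys
    x∈ys = xs⊆ys (here refl)
    xs⊆ys─x : xs ⊆ remove ys x∈ys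
    xs⊆ys─x z∈xs = ∈-remove⁺ ys x∈ys (xs⊆ys (there z∈xs)) (All.lookup x∉xs z∈xs ∘ sym)

sumsOfPairs : (ℕ → ℕ) → ℕ → List ℕ
sumsOfPairs w zero    = []
sumsOfPairs w (suc n) = applyUpTo (λ i → w (suc i) + w n) n ++ sumsOfPairs w n

length-sumsOfPairs : ∀ w n → length (sumsOfPairs w n) ≡ n C 2
length-sumsOfPairs w zero    = refl
length-sumsOfPairs w (suc n) = begin
  length (applyUpTo (λ i → w (suc i) + w n) n ++ sumsOfPairs w n)
    ≡⟨ length-++ (applyUpTo (λ i → w (suc i) + w n) n) ⟩
  length (applyUpTo (λ i → w (suc i) + w n) n) + length (sumsOfPairs w n)
    ≡⟨ cong₂ _+_ (trans (length-applyUpTo _ n) (sym (nC1≡n n))) (length-sumsOfPairs w n) ⟩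
  n C 1 + n C 2
    ≡⟨ nCk+nC[k+1]≡[n+1]C[k+1] n 1 ⟩
  suc n C 2 ∎
  where open ≡-Reasoning

∈-sumsOfPairs : ∀ w {n i j} → 1 ≤ i → i ≤ j → j < n → w i + w j ∈ sumsOfPairs w n
∈-sumsOfPairs w {suc n} {suc i} (s≤s _) i≤j j<1+n with m≤n⇒m<n∨m≡n (s≤s⁻¹ j<1+n)
... | inj₂ refl = ∈-++⁺ˡ (∈-applyUpTo⁺ (λ i → w (suc i) + w n) i≤j)
... | inj₁ j<n  = ∈-++⁺ʳ _ (∈-sumsOfPairs w (s≤s z≤n) i≤j j<n)

InApery-summand : ∀ S {n s a b} → InApery S n s → mem S a → mem S b → a + b ≡ s →
                  InApery S n a
InApery-summand S {n} {s} {a} {b} (_ , s-n∉S) a∈S b∈S a+b≡s =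
  a∈S , λ { (n≤a , t , t+n≡a , t∈S) →
    s-n∉S (≤-trans n≤a (subst (a ≤_) a+b≡s (m≤m+n a b)) ,
           t + b , t+b+n≡s t+n≡a , closed S t b t∈S b∈S) }
  where
  t+b+n≡s : ∀ {t} → t + n ≡ a → t + b + n ≡ s
  t+b+n≡s {t} t+n≡a = begin
    t + b + n    ≡⟨ +-assoc t b n ⟩
    t + (b + n)  ≡⟨ cong (t +_) (+-comm b n) ⟩
    t + (n + b)  ≡⟨ +-assoc t n b ⟨
    t + n + b    ≡⟨ cong (_+ b) t+n≡a ⟩
    a + b        ≡⟨ a+b≡s ⟩
    s            ∎
    where open ≡-Reasoning

n∉Apery[n] : ∀ S n → ¬ InApery S n n
n∉Apery[n] S n (_ , n-n∉S) = n-n∉S (≤-refl , 0 , refl , zero∈ S)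

multiplicity⇒minimalGenerator : ∀ S {m} → IsMultiplicity S m → IsMinimalGenerator S m
multiplicity⇒minimalGenerator S {m} (m∈S , m≢0 , m-least) =
  m∈S , m≢0 , λ { (x , y , x∈S , x≢0 , _ , y≢0 , x+y≡m) →
    <⇒≱ (subst (x <_) x+y≡m (m<m+n x (n≢0⇒n>0 y≢0))) (m-least x x∈S x≢0) }

module AperyListing (S : NumericalSemigroup) {m : ℕ} {w : ℕ → ℕ}
                    (isMultiplicity : IsMultiplicity S m) (listing : IsAperyListing S m w) where

  w-increasing : ∀ i j → i < j → j < m → w i < w j
  w-increasing = proj₁ listing

  w-InApery : ∀ i → i < m → InApery S m (w i)
  w-InApery = proj₁ (proj₂ listing)

  w-onto : ∀ s → InApery S m s → ∃ λ i → i < m × w i ≡ s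
  w-onto = proj₂ (proj₂ listing)

  w-mono : ∀ {i j} → i ≤ j → j < m → w i ≤ w j
  w-mono {i} {j} i≤j j<m with m≤n⇒m<n∨m≡n i≤j
  ... | inj₁ i<j  = <⇒≤ (w-increasing i j i<j j<m)
  ... | inj₂ refl = ≤-refl

  w0≡0 : w 0 ≡ 0
  w0≡0 with w-onto 0 (zero∈ S , λ (m≤0 , _) → proj₁ (proj₂ isMultiplicity) (n≤0⇒n≡0 m≤0))
  ... | zero  , _   , w0≡0 = w0≡0
  ... | suc i , i<m , wi≡0 = contradiction (subst (w 0 <_) wi≡0 (w-increasing 0 (suc i) z<s i<m)) n≮0

  w≢0⇒1≤i : ∀ i → w i ≢ 0 → 1 ≤ i
  w≢0⇒1≤i zero    w0≢0 = contradiction w0≡0 w0≢0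
  w≢0⇒1≤i (suc i) _    = s≤s z≤n

  1≤i⇒w≢0 : ∀ {i} → 1 ≤ i → i < m → w i ≢ 0
  1≤i⇒w≢0 {i} 1≤i i<m wi≡0 = n≮0 (subst₂ _<_ w0≡0 wi≡0 (w-increasing 0 i 1≤i i<m))

  sum⇒pairOfIndices : ∀ {k x y} → k < m →
                      mem S x → x ≢ 0 → mem S y → y ≢ 0 → x + y ≡ w k →
                      ∃₂ λ i j → 1 ≤ i × i ≤ j × j < m × w i + w j ≡ w k
  sum⇒pairOfIndices {k} {x} {y} k<m x∈S x≢0 y∈S y≢0 x+y≡wk
    with w-onto x (InApery-summand S (w-InApery k k<m) x∈S y∈S x+y≡wk)
       | w-onto y (InApery-summand S (w-InApery k k<m) y∈S x∈S (trans (+-comm y x) x+y≡wk))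
  ... | i , i<m , refl | j , j<m , refl with i ≤? j
  ...   | yes i≤j = i , j , w≢0⇒1≤i i x≢0 , i≤j , j<m , x+y≡wk
  ...   | no  i≰j =
    j , i , w≢0⇒1≤i j y≢0 , <⇒≤ (≰⇒> i≰j) , i<m , trans (+-comm (w j) (w i)) x+y≡wk

  <w1+wα⇒<α : ∀ {α i j} → 1 ≤ i → i < m → j < m → w i + w j < w 1 + w α → j < α
  <w1+wα⇒<α {α} {i} {j} 1≤i i<m j<m wi+wj<w1+wα with α ≤? j
  ... | no  α≰j = ≰⇒> α≰j
  ... | yes α≤j = contradiction (+-mono-≤ (w-mono 1≤i i<m) (w-mono α≤j j<m)) (<⇒≱ wi+wj<w1+wα)

  ∈-sumsOfPairs⊎minimalGenerator : ∀ {α k} → 1 ≤ k → k < m → w k < w 1 + w α →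
                                   w k ∈ sumsOfPairs w α ⊎ IsMinimalGenerator S (w k)
  ∈-sumsOfPairs⊎minimalGenerator {α} {k} 1≤k k<m wk<w1+wα with w k ∈? sumsOfPairs w α
  ... | yes wk∈sums = inj₁ wk∈sums
  ... | no  wk∉sums = inj₂ (proj₁ (w-InApery k k<m) , 1≤i⇒w≢0 1≤k k<m ,
          λ (_ , _ , x∈S , x≢0 , y∈S , y≢0 , x+y≡wk) →
            wk∉sums (decomposition⇒∈ x∈S x≢0 y∈S y≢0 x+y≡wk))
    where
    decomposition⇒∈ : ∀ {x y} → mem S x → x ≢ 0 → mem S y → y ≢ 0 → x + y ≡ w k →
                      w k ∈ sumsOfPairs w α
    decomposition⇒∈ x∈S x≢0 y∈S y≢0 x+y≡wk
      with i , j , 1≤i , i≤j , j<m , wi+wj≡wk ← sum⇒pairOfIndices k<m x∈S x≢0 y∈S y≢0 x+y≡wk =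
      subst (_∈ sumsOfPairs w α) wi+wj≡wk
        (∈-sumsOfPairs w 1≤i i≤j
          (<w1+wα⇒<α 1≤i (≤-<-trans i≤j j<m) j<m
            (subst (_< w 1 + w α) (sym wi+wj≡wk) wk<w1+wα)))

m≤ν+αC2 : ∀ S {m ν w α} → IsMultiplicity S m → IsEmbeddingDimension S ν →
          IsAperyListing S m w → w (m ∸ 1) < w 1 + w α → m ≤ ν + α C 2
m≤ν+αC2 S {zero} (_ , m≢0 , _) _ _ _ = contradiction refl m≢0
m≤ν+αC2 S {suc m} {ν} {w} {α} isMultiplicity (L , _ , generators , length[L]≡ν) listing wm<w1+wα =
  begin
    suc m                                   ≡⟨ cong suc (length-applyUpTo (w ∘ suc) m) ⟨
    length candidates                       ≤⟨ Unique∧⊆⇒length≤ candidates-unique candidates⊆ ⟩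
    length (sumsOfPairs w α ++ L)           ≡⟨ length-++ (sumsOfPairs w α) ⟩
    length (sumsOfPairs w α) + length L     ≡⟨ cong₂ _+_ (length-sumsOfPairs w α) length[L]≡ν ⟩
    α C 2 + ν                               ≡⟨ +-comm (α C 2) ν ⟩
    ν + α C 2                               ∎
  where
  open ≤-Reasoning
  open AperyListing S isMultiplicity listing

  candidates : List ℕ
  candidates = suc m ∷ applyUpTo (w ∘ suc) m

  candidates-unique : Unique candidates
  candidates-unique =
    All.tabulate m≢w ∷
    applyUpTo⁺₁ (w ∘ suc) m (λ i<j j<m → <⇒≢ (w-increasing _ _ (s≤s i<j) (s≤s j<m)))
    where
    m≢w : ∀ {v} → v ∈ applyUpTo (w ∘ suc) m → suc m ≢ v
    m≢w v∈ m≡v with i , i<m , refl ← ∈-applyUpTo⁻ (w ∘ suc) v∈ =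
      n∉Apery[n] S (suc m) (subst (InApery S (suc m)) (sym m≡v) (w-InApery (suc i) (s≤s i<m)))

  generator∈ : ∀ {x} → IsMinimalGenerator S x → x ∈ sumsOfPairs w α ++ L
  generator∈ = ∈-++⁺ʳ (sumsOfPairs w α) ∘ Equivalence.from (generators _)

  candidates⊆ : candidates ⊆ sumsOfPairs w α ++ L
  candidates⊆ (here refl) = generator∈ (multiplicity⇒minimalGenerator S isMultiplicity)
  candidates⊆ (there wk∈) with i , i<m , refl ← ∈-applyUpTo⁻ (w ∘ suc) wk∈ =
    [ ∈-++⁺ˡ , generator∈ ]
      (∈-sumsOfPairs⊎minimalGenerator (s≤s z≤n) (s≤s i<m)
        (≤-<-trans (w-mono i<m (n<1+n m)) wm<w1+wα))

lemma2 : (S : NumericalSemigroup) (m ν : ℕ) (w : ℕ → ℕ) →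
         IsMultiplicity S m → IsEmbeddingDimension S ν → IsAperyListing S m w →
         (α : ℕ) → 1 ≤ α → ν + α C 2 < m →
         w 1 + w α ≤ w (m ∸ 1)
lemma2 S m ν w isMultiplicity embeddingDimension listing α _ ν+αC2<m =
  ≮⇒≥ λ wm-1<w1+wα →
    <⇒≱ ν+αC2<m (m≤ν+αC2 S isMultiplicity embeddingDimension listing wm-1<w1+wα)
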